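{- Let $H=(U,(A_1,\dots,A_m))$ be a complete harmonic set system with $|U|<m(m-2)$ and $m\ge 51$, such that $\bigcap_{i\in I}A_i=\varnothing$ for every nonconsecutive $I\subseteq[m]$ with $|I|=3$. Then $|U|$ is a nonnegative integer linear combination of $m$, $m+1$, $\binom{m}{2}$ and $\frac{(m+1)(m-2)}{2}$.
   Context: A set of integers is nonconsecutive if no two distinct elements differ by exactly $1$. A set system $H=(U,(A_1,\dots,A_m))$ is complete if $\bigcup_i A_i=U$. For $I\subseteq[m]$, $H_I=\bigcap_{i\in I}A_i$ ($=U$ if $I=\varnothing$). The run decomposition of a finite set $I$ of positive integers is the partition formed by the sizes, sorted nonincreasingly, of the maximal runs of consecutive integers in $I$. $H$ is harmonic if $|H_I|=|H_J|$ whenever $I,J\subseteq[m]$ have the same run decomposition. -}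

module Defs where

open import Data.Bool using (Bool; true; false)
open import Data.Nat using (ℕ; zero; suc; _+_; _*_; _∸_; _<_; _≤_)
open import Data.Nat.Properties using (≤-decTotalOrder)
open import Data.Nat.Combinatorics using (_C_)
open import Data.Nat.DivMod using (_/_)
open import Data.Fin using (Fin; toℕ)
open import Data.Fin.Subset using (Subset; _∈_; ⋂; ∣_∣)
open import Data.Fin.Subset.Properties using (_∈?_)
open import Data.List using (List; []; _∷_; _++_; filter; map; reverse)
open import Data.List.Sort.InsertionSort ≤-decTotalOrder using (sort)
open import Data.Vec using (toList)
open import Data.Product using (Σ; ∃; _×_)
open import Relation.Binary.PropositionalEquality using (_≡_; _≢_)
open import Data.List using () renaming (allFin to allFinL)

-- A set system on ground set U = Fin n with m sets A₀,…,A_{m-1}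
-- (index i : Fin m stands for the paper's index i+1 ∈ [m]).
SetSystem : ℕ → ℕ → Set
SetSystem n m = Fin m → Subset n

elems : ∀ {m} → Subset m → List (Fin m)
elems I = filter (_∈? I) (allFinL _)

-- H_I = ⋂_{i∈I} A_i, with H_∅ = U
H : ∀ {n m} → SetSystem n m → Subset m → Subset n
H A I = ⋂ (map A (elems I))

Complete : ∀ {n m} → SetSystem n m → Set
Complete {n} {m} A = (u : Fin n) → ∃ λ (i : Fin m) → u ∈ A i

-- sizes of maximal runs of consecutive elements (scanning the
-- characteristic vector); c = length of the current run
runsAux : ℕ → List Bool → List ℕ
runsAux zero    []           = []
runsAux (suc c) []           = suc c ∷ []
runsAux c       (true ∷ xs)  = runsAux (suc c) xs
runsAux zero    (false ∷ xs) = runsAux zero xs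
runsAux (suc c) (false ∷ xs) = suc c ∷ runsAux zero xs

runDecomposition : ∀ {m} → Subset m → List ℕ
runDecomposition I = reverse (sort (runsAux zero (toList I)))

Harmonic : ∀ {n m} → SetSystem n m → Set
Harmonic {n} {m} A = (I J : Subset m) →
  runDecomposition I ≡ runDecomposition J → ∣ H A I ∣ ≡ ∣ H A J ∣

Nonconsecutive : ∀ {m} → Subset m → Set
Nonconsecutive {m} I = (i j : Fin m) → i ∈ I → j ∈ I → toℕ i ≢ suc (toℕ j)

NonnegComb : ℕ → ℕ → Set
NonnegComb m k = Σ ℕ λ a → Σ ℕ λ b → Σ ℕ λ c → Σ ℕ λ d →
  k ≡ a * m + b * (m + 1) + c * (m C 2) + d * (((m + 1) * (m ∸ 2)) / 2)

-- Write h(I) = |H_I|. Harmonicity makes h(I) depend only on the run decomposition of I, as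
-- one sees by translating I and shrinking its gaps. Every I containing a nonconsecutive
-- triple has h(I) = 0, so each element lies in at most four of the A_i and only the values
-- a, …, g of h on the run decompositions 1, 2, 11, 3, 21, 4, 22 survive. Counting the pairs
-- (u, I) with u ∈ H_I and |I| = j gives Σ_u C(α_u, j), where α_u is the number of sets
-- containing u, as a polynomial in m and a, …, g; since 1 ≤ α_u ≤ 4 the alternating sum of
-- these vanishes, which expresses n. Truncated inclusion–exclusion at the first positions and
-- inequalities between the columns of a window of seven positions (checked on all 2⁷ columns)
-- then leave, together with n < m(m − 2), only a few cases, each of which writes n as a
-- combination of m, m + 1, C(m, 2) and (m + 1)(m − 2)/2.

module Submission where

open import Data.Bool using (Bool; true; false; _∧_; _∨_; T)
open import Data.Bool.ListAction using (all; or)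
open import Data.Bool.Properties using (∧-conicalˡ; ∧-conicalʳ; ∧-assoc; T-∧; ⇔→≡)
open import Data.Fin using (Fin; zero; suc; toℕ; fromℕ<)
open import Data.Fin.Properties using (toℕ<n; fromℕ<-toℕ; toℕ-fromℕ<)
open import Data.Fin.Subset using (Subset; _∈_; ∣_∣; ⋂; ⊥)
open import Data.Fin.Subset.Properties using (_∈?_; x∈p∩q⁺; x∈p∩q⁻; ∈⊤; ∣⊥∣≡0)
open import Data.List using (List; []; _∷_; _++_; length; map; replicate; reverse) renaming (allFin to allFinL)
open import Data.List.Membership.Propositional.Properties using (∈-filter⁺; ∈-filter⁻; ∈-allFin)
open import Data.List.Properties using (≡-dec)
open import Data.List.Relation.Unary.All as All using (All)
import Data.List.Relation.Unary.All.Properties as All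
open import Data.List.Relation.Unary.Linked as Linked using (Linked; linked?)
open import Data.Nat using (ℕ; zero; suc; _+_; _*_; _∸_; _≤_; _<_; z≤n; s≤s; _≤ᵇ_; _≟_; _<?_; _≤?_)
open import Data.Nat.Combinatorics using (_C_; nCk+nC[k+1]≡[n+1]C[k+1]; nC1≡n)
open import Data.Nat.DivMod using (_/_; m*n/n≡m)
open import Data.Nat.ListAction using (sum)
open import Data.Nat.Properties
open import Data.Nat.Tactic.RingSolver using (solve; solve-∀)
open import Data.Product using (_×_; _,_; proj₁; proj₂; ∃-syntax)
open import Data.Sum using (_⊎_; inj₁; inj₂)
open import Data.Unit using (⊤)
open import Data.Vec as Vec using (tabulate; toList; lookup)
open import Data.Vec.Properties using (lookup∘tabulate; []=⇒lookup; lookup⇒[]=)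
open import Data.List.Sort.InsertionSort ≤-decTotalOrder using (sort)
open import Algebra.Properties.CommutativeMonoid.Sum +-0-commutativeMonoid
  using (sum-syntax; sum-cong-≗; ∑-distrib-+; sum-replicate-zero)
open import Defs
open import Function using (_∘_)
open import Function.Bundles using (mk⇔; Equivalence)
open import Relation.Binary.PropositionalEquality
open import Relation.Nullary using (yes; no; contradiction)
open import Relation.Nullary.Decidable using (Dec; _×-dec_; True; toWitness)

-- Sums over the subsets of a window

bit : Bool → ℕ
bit false = 0
bit true  = 1

all-++ : ∀ (c : ℕ → Bool) p t → all c (p ++ t) ≡ all c p ∧ all c t
all-++ c []      t = refl
all-++ c (i ∷ p) t rewrite all-++ c p t = sym (∧-assoc (c i) (all c p) (all c t))

countIn : (ℕ → Bool) → ℕ → ℕ → ℕ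
countIn c o zero    = 0
countIn c o (suc L) = bit (c o) + countIn c (suc o) L

-- Σ F t over the increasing k-element lists t of elements of [o, o + L)
subsetSum : (List ℕ → ℕ) → ℕ → ℕ → ℕ → ℕ
subsetSum F o L       zero    = F []
subsetSum F o zero    (suc k) = 0
subsetSum F o (suc L) (suc k) = subsetSum F (suc o) L (suc k) + subsetSum (F ∘ (o ∷_)) (suc o) L k

subsetSum-cong : ∀ {F G} → (∀ t → F t ≡ G t) → ∀ o L k → subsetSum F o L k ≡ subsetSum G o L k
subsetSum-cong F≗G o L       zero    = F≗G []
subsetSum-cong F≗G o zero    (suc k) = refl
subsetSum-cong F≗G o (suc L) (suc k) =
  cong₂ _+_ (subsetSum-cong F≗G (suc o) L (suc k)) (subsetSum-cong (F≗G ∘ (o ∷_)) (suc o) L k)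

subsetSum-0 : ∀ o L k → subsetSum (λ _ → 0) o L k ≡ 0
subsetSum-0 o L       zero    = refl
subsetSum-0 o zero    (suc k) = refl
subsetSum-0 o (suc L) (suc k) = cong₂ _+_ (subsetSum-0 (suc o) L (suc k)) (subsetSum-0 (suc o) L k)

subsetSum-∧ : ∀ c b o L k → subsetSum (λ t → bit (b ∧ all c t)) o L k ≡ bit b * subsetSum (bit ∘ all c) o L k
subsetSum-∧ c true  o L k = sym (+-identityʳ _)
subsetSum-∧ c false o L k = subsetSum-0 o L k

pascal-bit : ∀ b x k → (bit b + x) C suc k ≡ x C suc k + bit b * (x C k)
pascal-bit true  x k = trans (sym (nCk+nC[k+1]≡[n+1]C[k+1] x k))
                             (trans (+-comm (x C k) _) (cong (x C suc k +_) (sym (*-identityˡ _))))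
pascal-bit false x k = sym (+-identityʳ _)

subsetSum-all : ∀ c o L k → subsetSum (bit ∘ all c) o L k ≡ countIn c o L C k
subsetSum-all c o L       zero    = refl
subsetSum-all c o zero    (suc k) = refl
subsetSum-all c o (suc L) (suc k) = begin
  subsetSum (bit ∘ all c) (suc o) L (suc k) + subsetSum (λ t → bit (c o ∧ all c t)) (suc o) L k
    ≡⟨ cong₂ _+_ (subsetSum-all c (suc o) L (suc k)) (subsetSum-∧ c (c o) (suc o) L k) ⟩
  countIn c (suc o) L C suc k + bit (c o) * subsetSum (bit ∘ all c) (suc o) L k
    ≡⟨ cong (λ s → countIn c (suc o) L C suc k + bit (c o) * s) (subsetSum-all c (suc o) L k) ⟩
  countIn c (suc o) L C suc k + bit (c o) * (countIn c (suc o) L C k)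
    ≡⟨ sym (pascal-bit (c o) (countIn c (suc o) L) k) ⟩
  countIn c o (suc L) C suc k ∎
  where open ≡-Reasoning

subsetSum-prefix : ∀ c p o L k →
  subsetSum (λ t → bit (all c (p ++ t))) o L k ≡ bit (all c p) * (countIn c o L C k)
subsetSum-prefix c p o L k = begin
  subsetSum (λ t → bit (all c (p ++ t))) o L k  ≡⟨ subsetSum-cong (λ t → cong bit (all-++ c p t)) o L k ⟩
  subsetSum (λ t → bit (all c p ∧ all c t)) o L k ≡⟨ subsetSum-∧ c (all c p) o L k ⟩
  bit (all c p) * subsetSum (bit ∘ all c) o L k   ≡⟨ cong (bit (all c p) *_) (subsetSum-all c o L k) ⟩
  bit (all c p) * (countIn c o L C k) ∎
  where open ≡-Reasoning

∑-subsetSum : ∀ {n} (F : Fin n → List ℕ → ℕ) o L k →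
  ∑[ u < n ] subsetSum (F u) o L k ≡ subsetSum (λ t → ∑[ u < n ] F u t) o L k
∑-subsetSum F o L       zero    = refl
∑-subsetSum {n} F o zero (suc k) = sum-replicate-zero n
∑-subsetSum F o (suc L) (suc k) =
  trans (∑-distrib-+ (λ u → subsetSum (F u) (suc o) L (suc k)) (λ u → subsetSum (F u ∘ (o ∷_)) (suc o) L k))
        (cong₂ _+_ (∑-subsetSum F (suc o) L (suc k)) (∑-subsetSum (λ u → F u ∘ (o ∷_)) (suc o) L k))

Inside : ℕ → ℕ → List ℕ → Set
Inside w o []      = ⊤
Inside w o (x ∷ t) = o ≤ x × x < w × Inside w (suc x) t

Inside-weaken : ∀ {w o} t → Inside w (suc o) t → Inside w o t
Inside-weaken []      _                = _
Inside-weaken (x ∷ t) (o<x , x<w , ins) = <⇒≤ o<x , x<w , ins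

subsetSum-congᵢ : ∀ {F G} w o L k → o + L ≤ w →
  (∀ t → Inside w o t → length t ≡ k → F t ≡ G t) → subsetSum F o L k ≡ subsetSum G o L k
subsetSum-congᵢ w o L       zero    _   F≗G = F≗G [] _ refl
subsetSum-congᵢ w o zero    (suc k) _   F≗G = refl
subsetSum-congᵢ w o (suc L) (suc k) o+L≤w F≗G =
  cong₂ _+_ (subsetSum-congᵢ w (suc o) L (suc k) le (λ t ins → F≗G t (Inside-weaken t ins)))
            (subsetSum-congᵢ w (suc o) L k le (λ t ins len → F≗G (o ∷ t) (≤-refl , o<w , ins) (cong suc len)))
  where
  le : suc o + L ≤ w
  le = subst (_≤ w) (+-suc o L) o+L≤w
  o<w : o < w
  o<w = <-≤-trans (s≤s (m≤m+n o L)) le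

subsetSum-const₁ : ∀ K o L → subsetSum (λ _ → K) o L 1 ≡ L * K
subsetSum-const₁ K o zero    = refl
subsetSum-const₁ K o (suc L) = trans (cong (_+ K) (subsetSum-const₁ K (suc o) L)) (+-comm (L * K) K)

subsetSum-singletons : ∀ {F} K w o L → o + L ≤ w →
  (∀ x → o ≤ x → x < w → F (x ∷ []) ≡ K) → subsetSum F o L 1 ≡ L * K
subsetSum-singletons {F} K w o L o+L≤w F≡K =
  trans (subsetSum-congᵢ w o L 1 o+L≤w F≗K) (subsetSum-const₁ K o L)
  where
  F≗K : ∀ t → Inside w o t → length t ≡ 1 → F t ≡ K
  F≗K (x ∷ []) (o≤x , x<w , _) _ = F≡K x o≤x x<w

subsetSum-vanishing : ∀ {F} w o L k → o + L ≤ w →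
  (∀ t → Inside w o t → length t ≡ k → F t ≡ 0) → subsetSum F o L k ≡ 0
subsetSum-vanishing w o L k o+L≤w F≗0 = trans (subsetSum-congᵢ w o L k o+L≤w F≗0) (subsetSum-0 o L k)

subsetSum-pairs : ∀ {F} K w o L → o + suc L ≤ w →
  (∀ y → o ≤ y → suc y < w → F (y ∷ suc y ∷ []) ≡ K) →
  (∀ y z → o ≤ y → suc y < z → z < w → F (y ∷ z ∷ []) ≡ 0) → subsetSum F o (suc L) 2 ≡ L * K
subsetSum-pairs K w o zero    _     _        _        = refl
subsetSum-pairs {F} K w o (suc L) o+L≤w adjacent apart = begin
  subsetSum F (suc o) (suc L) 2 + (subsetSum (F ∘ (o ∷_)) (suc (suc o)) L 1 + F (o ∷ suc o ∷ []))
    ≡⟨ cong₂ _+_ (subsetSum-pairs K w (suc o) L le (λ y → adjacent y ∘ <⇒≤) (λ y z → apart y z ∘ <⇒≤))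
                 (cong₂ _+_ (subsetSum-singletons 0 w (suc (suc o)) L le′ (λ z → apart o z ≤-refl))
                            (adjacent o ≤-refl (<-≤-trans (s≤s (s≤s (m≤m+n o L))) le′))) ⟩
  L * K + (L * 0 + K)
    ≡⟨ rearrange L K ⟩
  suc L * K ∎
  where
  open ≡-Reasoning
  rearrange : ∀ L K → L * K + (L * 0 + K) ≡ suc L * K
  rearrange = solve-∀
  le : suc o + suc L ≤ w
  le = subst (_≤ w) (+-suc o (suc L)) o+L≤w
  le′ : suc (suc o) + L ≤ w
  le′ = subst (_≤ w) (+-suc (suc o) L) le

suc-C2 : ∀ L → suc L C 2 ≡ L + L C 2
suc-C2 L = trans (sym (nCk+nC[k+1]≡[n+1]C[k+1] L 1)) (cong (_+ L C 2) (nC1≡n L))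

C2-double : ∀ x → suc x C 2 + suc x C 2 ≡ suc x * x
C2-double zero    = refl
C2-double (suc x) = begin
  suc (suc x) C 2 + suc (suc x) C 2              ≡⟨ cong₂ _+_ (suc-C2 (suc x)) (suc-C2 (suc x)) ⟩
  suc x + suc x C 2 + (suc x + suc x C 2)        ≡⟨ regroup (suc x) (suc x C 2) ⟩
  suc x + suc x + (suc x C 2 + suc x C 2)        ≡⟨ cong (suc x + suc x +_) (C2-double x) ⟩
  suc x + suc x + suc x * x                      ≡⟨ expand x ⟩
  suc (suc x) * suc x                            ∎
  where
  open ≡-Reasoning
  regroup : ∀ y z → y + z + (y + z) ≡ y + y + (z + z)
  regroup = solve-∀
  expand : ∀ x → suc x + suc x + suc x * x ≡ suc (suc x) * suc x
  expand = solve-∀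

-- Index sets given by a first position and gaps

-- x, x + 1 + g₁, x + 2 + g₁ + g₂, …
positions : ℕ → List ℕ → List ℕ
following : ℕ → List ℕ → List ℕ
positions x gs = x ∷ following x gs
following x []       = []
following x (g ∷ gs) = positions (suc (g + x)) gs

lastPosition : ℕ → List ℕ → ℕ
lastPosition x []       = x
lastPosition x (g ∷ gs) = lastPosition (suc (g + x)) gs

falses : ℕ → List Bool → List Bool
falses zero    l = l
falses (suc x) l = false ∷ falses x l

-- the characteristic word of positions x gs, followed by r further falses
word  : ℕ → List ℕ → ℕ → List Bool
after : List ℕ → ℕ → List Bool
word x gs r = falses x (true ∷ after gs r)
after []       r = falses r []
after (g ∷ gs) r = word g gs r

runsAfter : ℕ → List ℕ → List ℕ
runsAfter c []           = suc c ∷ []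
runsAfter c (zero  ∷ gs) = runsAfter (suc c) gs
runsAfter c (suc _ ∷ gs) = suc c ∷ runsAfter zero gs

compress : List ℕ → List ℕ
compress []           = []
compress (zero  ∷ gs) = 0 ∷ compress gs
compress (suc _ ∷ gs) = 1 ∷ compress gs

runsAux-falses : ∀ x l → runsAux 0 (falses x l) ≡ runsAux 0 l
runsAux-falses zero    l = refl
runsAux-falses (suc x) l = runsAux-falses x l

runsAux-after : ∀ c gs r → runsAux (suc c) (after gs r) ≡ runsAfter c gs
runsAux-after c []           zero    = refl
runsAux-after c []           (suc r) = cong (suc c ∷_) (runsAux-falses r [])
runsAux-after c (zero  ∷ gs) r       = runsAux-after (suc c) gs r
runsAux-after c (suc g ∷ gs) r       = cong (suc c ∷_) (trans (runsAux-falses g _) (runsAux-after 0 gs r))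

runsAux-word : ∀ x gs r → runsAux 0 (word x gs r) ≡ runsAfter 0 gs
runsAux-word x gs r = trans (runsAux-falses x _) (runsAux-after 0 gs r)

runsAfter-compress : ∀ c gs → runsAfter c (compress gs) ≡ runsAfter c gs
runsAfter-compress c []           = refl
runsAfter-compress c (zero  ∷ gs) = runsAfter-compress (suc c) gs
runsAfter-compress c (suc _ ∷ gs) = cong (suc c ∷_) (runsAfter-compress 0 gs)

lastPosition-compress : ∀ {x y} gs → x ≤ y → lastPosition x (compress gs) ≤ lastPosition y gs
lastPosition-compress []           x≤y = x≤y
lastPosition-compress (zero  ∷ gs) x≤y = lastPosition-compress gs (s≤s x≤y)
lastPosition-compress (suc g ∷ gs) x≤y = lastPosition-compress gs (s≤s (s≤s (≤-trans x≤y (m≤n+m _ g))))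

compress-< : ∀ {x w} gs → lastPosition x gs < w → lastPosition 0 (compress gs) < w
compress-< gs = ≤-<-trans (lastPosition-compress gs z≤n)

length-falses : ∀ x l → length (falses x l) ≡ x + length l
length-falses zero    l = refl
length-falses (suc x) l = cong suc (length-falses x l)

length-word : ∀ o x gs r → o + length (word x gs r) ≡ suc (lastPosition (o + x) gs + r)
length-word o x gs r = begin
  o + length (falses x (true ∷ after gs r))  ≡⟨ cong (o +_) (length-falses x _) ⟩
  o + (x + suc (length (after gs r)))        ≡⟨ +-suc-assoc o x (length (after gs r)) ⟩
  suc (o + x) + length (after gs r)          ≡⟨ length-after gs ⟩
  suc (lastPosition (o + x) gs + r)          ∎
  where
  open ≡-Reasoning
  +-suc-assoc : ∀ o x ℓ → o + (x + suc ℓ) ≡ suc (o + x) + ℓ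
  +-suc-assoc = solve-∀
  length-after : ∀ gs → suc (o + x) + length (after gs r) ≡ suc (lastPosition (o + x) gs + r)
  length-after []       = trans (cong (suc (o + x) +_) (length-falses r [])) (cong (λ k → suc (o + x + k)) (+-identityʳ r))
  length-after (g ∷ gs) = trans (length-word (suc (o + x)) g gs r)
                                (cong (λ p → suc (lastPosition (suc p) gs + r)) (+-comm (o + x) g))

at : List Bool → ℕ → Bool
at []      _       = false
at (b ∷ l) zero    = b
at (b ∷ l) (suc j) = at l j

at-falses : ∀ r j → at (falses r []) j ≡ false
at-falses zero    j       = refl
at-falses (suc r) zero    = refl
at-falses (suc r) (suc j) = at-falses r j

at-< : ∀ l j → at l j ≡ true → j < length l
at-< (b ∷ l) zero    _  = s≤s z≤n
at-< (b ∷ l) (suc j) eq = s≤s (at-< l j eq)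

allOn : (ℕ → Bool) → List Bool → ℕ → Bool
allOn c []          o = true
allOn c (true ∷ l)  o = c o ∧ allOn c l (suc o)
allOn c (false ∷ l) o = allOn c l (suc o)

allOn-falses : ∀ c x l o → allOn c (falses x l) o ≡ allOn c l (o + x)
allOn-falses c zero    l o = cong (allOn c l) (sym (+-identityʳ o))
allOn-falses c (suc x) l o = trans (allOn-falses c x l (suc o)) (cong (allOn c l) (sym (+-suc o x)))

allOn-word : ∀ c x gs r o → allOn c (word x gs r) o ≡ all c (positions (o + x) gs)
allOn-word c x gs r o = trans (allOn-falses c x _ o) (allOn-after gs)
  where
  allOn-after : ∀ gs → allOn c (true ∷ after gs r) (o + x) ≡ all c (positions (o + x) gs)
  allOn-after []       = cong (c (o + x) ∧_) (allOn-falses c r [] _)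
  allOn-after (g ∷ gs) = cong (c (o + x) ∧_) (trans (allOn-word c g gs r (suc (o + x)))
                                                    (cong (λ p → all c (positions (suc p) gs)) (+-comm (o + x) g)))

allOn⇒ : ∀ c l o → allOn c l o ≡ true → ∀ j → at l j ≡ true → c (o + j) ≡ true
allOn⇒ c (true  ∷ l) o ok zero    _  = trans (cong c (+-identityʳ o)) (∧-conicalˡ _ _ ok)
allOn⇒ c (true  ∷ l) o ok (suc j) lj = trans (cong c (+-suc o j)) (allOn⇒ c l (suc o) (∧-conicalʳ _ _ ok) j lj)
allOn⇒ c (false ∷ l) o ok (suc j) lj = trans (cong c (+-suc o j)) (allOn⇒ c l (suc o) ok j lj)

⇒allOn : ∀ c l o → (∀ j → at l j ≡ true → c (o + j) ≡ true) → allOn c l o ≡ true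
⇒allOn c []          o _  = refl
⇒allOn c (true  ∷ l) o ok = cong₂ _∧_ (trans (cong c (sym (+-identityʳ o))) (ok 0 refl))
                                      (⇒allOn c l (suc o) (λ j lj → trans (cong c (sym (+-suc o j))) (ok (suc j) lj)))
⇒allOn c (false ∷ l) o ok = ⇒allOn c l (suc o) (λ j lj → trans (cong c (sym (+-suc o j))) (ok (suc j) lj))

vecOf : ∀ {k} → List Bool → Subset k
vecOf l = tabulate (at l ∘ toℕ)

toList-vecOf : ∀ l → toList (vecOf {length l} l) ≡ l
toList-vecOf []      = refl
toList-vecOf (b ∷ l) = cong (b ∷_) (toList-vecOf l)

∈vecOf⁺ : ∀ {k} l (i : Fin k) → at l (toℕ i) ≡ true → i ∈ vecOf l
∈vecOf⁺ l i li = lookup⇒[]= i _ (trans (lookup∘tabulate (at l ∘ toℕ) i) li)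

∈vecOf⁻ : ∀ {k} l (i : Fin k) → i ∈ vecOf l → at l (toℕ i) ≡ true
∈vecOf⁻ l i i∈ = trans (sym (lookup∘tabulate (at l ∘ toℕ) i)) ([]=⇒lookup i∈)

∣∣≡∑ : ∀ {k} (p : Subset k) → ∣ p ∣ ≡ ∑[ i < k ] bit (lookup p i)
∣∣≡∑ Vec.[]            = refl
∣∣≡∑ (true  Vec.∷ p) = cong suc (∣∣≡∑ p)
∣∣≡∑ (false Vec.∷ p) = ∣∣≡∑ p

∈⋂⁺ : ∀ {k} {x : Fin k} ps → All (x ∈_) ps → x ∈ ⋂ ps
∈⋂⁺ []       All.[]         = ∈⊤
∈⋂⁺ (p ∷ ps) (x∈p All.∷ x∈) = x∈p∩q⁺ (x∈p , ∈⋂⁺ ps x∈)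

∈⋂⁻ : ∀ {k} {x : Fin k} ps → x ∈ ⋂ ps → All (x ∈_) ps
∈⋂⁻ []       _  = All.[]
∈⋂⁻ (p ∷ ps) x∈ = let x∈p , x∈⋂ = x∈p∩q⁻ p (⋂ ps) x∈ in x∈p All.∷ ∈⋂⁻ ps x∈⋂

gap : ∀ {x y} → suc x < y → ∃[ g ] y ≡ suc (suc g + x)
gap {x} x+1<y = let g , eq = m≤n⇒∃[o]m+o≡n x+1<y in g , trans (sym eq) (cong (λ k → suc (suc k)) (+-comm x g))

∣vecOf-falses∣ : ∀ r → ∣ vecOf {length (falses r [])} (falses r []) ∣ ≡ 0
∣vecOf-falses∣ zero    = refl
∣vecOf-falses∣ (suc r) = ∣vecOf-falses∣ r

∑-mono-≤ : ∀ {k} (f g : Fin k → ℕ) → (∀ i → f i ≤ g i) → ∑[ i < k ] f i ≤ ∑[ i < k ] g i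
∑-mono-≤ {zero}  f g f≤g = z≤n
∑-mono-≤ {suc k} f g f≤g = +-mono-≤ (f≤g zero) (∑-mono-≤ (f ∘ suc) (g ∘ suc) (f≤g ∘ suc))

∑≡0⇒ : ∀ {k} (f : Fin k → ℕ) → ∑[ i < k ] f i ≡ 0 → ∀ i → f i ≡ 0
∑≡0⇒ f ∑≡0 zero    = m+n≡0⇒m≡0 (f zero) ∑≡0
∑≡0⇒ f ∑≡0 (suc i) = ∑≡0⇒ (f ∘ suc) (m+n≡0⇒n≡0 (f zero) ∑≡0) i

bit-all-drop : ∀ (c : ℕ → Bool) t₁ y t₂ → bit (all c (t₁ ++ y ∷ t₂)) ≤ bit (all c (t₁ ++ t₂))
bit-all-drop c []       y t₂ with c y
... | true  = ≤-refl
... | false = z≤n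
bit-all-drop c (x ∷ t₁) y t₂ with c x
... | true  = bit-all-drop c t₁ y t₂
... | false = z≤n

-- Column inequalities checked on a window

window : (ℕ → Bool) → ℕ → List Bool
window c zero    = []
window c (suc w) = c 0 ∷ window (c ∘ suc) w

at-window : ∀ c w i → i < w → at (window c w) i ≡ c i
at-window c (suc w) zero    _         = refl
at-window c (suc w) (suc i) (s≤s i<w) = at-window (c ∘ suc) w i i<w

allBits : ℕ → (List Bool → Bool) → Bool
allBits zero    p = p []
allBits (suc w) p = allBits w (p ∘ (true ∷_)) ∧ allBits w (p ∘ (false ∷_))

allBits-window : ∀ w p → T (allBits w p) → ∀ c → T (p (window c w))
allBits-window zero    p ok c = ok
allBits-window (suc w) p ok c with c 0 | Equivalence.to T-∧ ok
... | true  | ok₁ , _   = allBits-window w (p ∘ (true ∷_)) ok₁ (c ∘ suc)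
... | false | _   , ok₀ = allBits-window w (p ∘ (false ∷_)) ok₀ (c ∘ suc)

map-all-window : ∀ c w ts → All (All (_< w)) ts → map (all (at (window c w))) ts ≡ map (all c) ts
map-all-window c w []       All.[]             = refl
map-all-window c w (t ∷ ts) (t<w All.∷ ts<w) = cong₂ _∷_ (all-window t t<w) (map-all-window c w ts ts<w)
  where
  all-window : ∀ t → All (_< w) t → all (at (window c w)) t ≡ all c t
  all-window []      All.[]           = refl
  all-window (i ∷ t) (i<w All.∷ t<w) = cong₂ _∧_ (at-window c w i i<w) (all-window t t<w)

ones : List Bool → ℕ
ones = sum ∘ map bit

holds : (ℕ → Bool) → (zs ls rs : List (List ℕ)) → Bool
holds c zs ls rs = or (map (all c) zs) ∨ (ones (map (all c) ls) ≤ᵇ ones (map (all c) rs))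

holds-window : ∀ c w zs ls rs → All (All (_< w)) (zs ++ ls ++ rs) → holds (at (window c w)) zs ls rs ≡ holds c zs ls rs
holds-window c w zs ls rs <w
  with All.++⁻ zs <w
... | zs<w , lrs<w with All.++⁻ ls lrs<w
... | ls<w , rs<w
  rewrite map-all-window c w zs zs<w | map-all-window c w ls ls<w | map-all-window c w rs rs<w = refl

or-false : ∀ bs → All (_≡ false) bs → or bs ≡ false
or-false []       All.[]           = refl
or-false (b ∷ bs) (refl All.∷ bs≡) = or-false bs bs≡

holds-sound : ∀ c zs ls rs → T (holds c zs ls rs) → All (λ z → all c z ≡ false) zs →
  ones (map (all c) ls) ≤ ones (map (all c) rs)
holds-sound c zs ls rs ok zs∉ rewrite or-false (map (all c) zs) (All.map⁺ zs∉) = ≤ᵇ⇒≤ _ _ ok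

gapsFrom : ℕ → List ℕ → List ℕ
gapsFrom x []      = []
gapsFrom x (y ∷ t) = y ∸ suc x ∷ gapsFrom y t

gap-suc : ∀ {x y} → x < y → suc (y ∸ suc x + x) ≡ y
gap-suc {x} {y} x<y = trans (sym (+-suc (y ∸ suc x) x)) (m∸n+n≡m x<y)

positions-gapsFrom : ∀ x t → Linked _<_ (x ∷ t) → positions x (gapsFrom x t) ≡ x ∷ t
positions-gapsFrom x []      _            = refl
positions-gapsFrom x (y ∷ t) (x<y Linked.∷ lnk) =
  cong (x ∷_) (trans (cong (λ p → positions p (gapsFrom y t)) (gap-suc x<y)) (positions-gapsFrom y t lnk))

lastPosition-gapsFrom : ∀ {w} x t → Linked _<_ (x ∷ t) → All (_< w) (x ∷ t) → lastPosition x (gapsFrom x t) < w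
lastPosition-gapsFrom x []      _                  (x<w All.∷ _) = x<w
lastPosition-gapsFrom x (y ∷ t) (x<y Linked.∷ lnk) (_ All.∷ <w)  =
  subst (λ p → lastPosition p (gapsFrom y t) < _) (sym (gap-suc x<y)) (lastPosition-gapsFrom y t lnk <w)

runDecompositionOf : List ℕ → List ℕ
runDecompositionOf []      = []
runDecompositionOf (x ∷ t) = reverse (sort (runsAfter 0 (gapsFrom x t)))

-- gaps placing runs of the given lengths one apart
layoutGaps : List ℕ → List ℕ
layoutGaps []           = []
layoutGaps (r ∷ [])     = replicate (r ∸ 1) 0
layoutGaps (r ∷ ρ@(_ ∷ _)) = replicate (r ∸ 1) 0 ++ 1 ∷ layoutGaps ρ

canonical : List ℕ → List ℕ
canonical t = positions 0 (layoutGaps (runDecompositionOf t))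

InWindow : ℕ → List ℕ → Set
InWindow w t = Linked _<_ t × All (_< w) t

inWindow? : ∀ w t → Dec (InWindow w t)
inWindow? w t = linked? _<?_ t ×-dec All.all? (_<? w) t

Admissible : ℕ → List ℕ → Set
Admissible w t = InWindow w t × InWindow w (canonical t) × runDecompositionOf t ≡ runDecompositionOf (canonical t)

admissible? : ∀ w t → Dec (Admissible w t)
admissible? w t = inWindow? w t ×-dec inWindow? w (canonical t)
  ×-dec ≡-dec _≟_ (runDecompositionOf t) (runDecompositionOf (canonical t))

Spread : ℕ → List ℕ → Set
Spread w t = Admissible w t × canonical t ≡ 0 ∷ 2 ∷ 4 ∷ []

spread? : ∀ w t → Dec (Spread w t)
spread? w t = admissible? w t ×-dec ≡-dec _≟_ (canonical t) (0 ∷ 2 ∷ 4 ∷ [])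

bit≡0⇒ : ∀ {b} → bit b ≡ 0 → b ≡ false
bit≡0⇒ {false} _ = refl

-- Truncated alternating sums of binomial coefficients

≤-by-computation : ∀ {a b} → {T (a ≤ᵇ b)} → a ≤ b
≤-by-computation {a} {b} {a≤b} = ≤ᵇ⇒≤ a b a≤b

alternating₃ : ∀ x s → (x ≡ true → s ≤ 3) → bit x * (s C 1) + bit x * (s C 3) ≤ bit x * (s C 0) + bit x * (s C 2)
alternating₃ false s _   = z≤n
alternating₃ true  s s≤3 with s≤3 refl
... | z≤n                   = ≤-by-computation
... | s≤s z≤n               = ≤-by-computation
... | s≤s (s≤s z≤n)         = ≤-by-computation
... | s≤s (s≤s (s≤s z≤n))   = ≤-by-computation

alternating₂ : ∀ x s → (x ≡ true → s ≤ 2) → bit x * (s C 1) ≤ bit x * (s C 0) + bit x * (s C 2)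
alternating₂ false s _   = z≤n
alternating₂ true  s s≤2 with s≤2 refl
... | z≤n             = ≤-by-computation
... | s≤s z≤n         = ≤-by-computation
... | s≤s (s≤s z≤n)   = ≤-by-computation

alternating-without : ∀ x y s → (x ≡ true → s ≤ 3) → (y ∧ x ≡ true → s ≤ 2) →
  bit x * (s C 1) + bit (y ∧ x) * (s C 0) + bit x * (s C 3) + bit (y ∧ x) * (s C 2)
    ≤ bit x * (s C 0) + bit x * (s C 2) + bit (y ∧ x) * (s C 1)
alternating-without false false s _ _ = z≤n
alternating-without false true  s _ _ = z≤n
alternating-without true  false s s≤3 _ with s≤3 refl
... | z≤n                   = ≤-by-computation
... | s≤s z≤n               = ≤-by-computation
... | s≤s (s≤s z≤n)         = ≤-by-computation
... | s≤s (s≤s (s≤s z≤n))   = ≤-by-computation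
alternating-without true  true  s _ s≤2 with s≤2 refl
... | z≤n             = ≤-by-computation
... | s≤s z≤n         = ≤-by-computation
... | s≤s (s≤s z≤n)   = ≤-by-computation

countIn-≥ : ∀ c o L x → o ≤ x → x < o + L → bit (c x) ≤ countIn c o L
countIn-≥ c o zero    x o≤x x<o+0 = contradiction (subst (x <_) (+-identityʳ o) x<o+0) (≤⇒≯ o≤x)
countIn-≥ c o (suc L) x o≤x x<o+L with m≤n⇒m<n∨m≡n o≤x
... | inj₂ refl = m≤m+n _ _
... | inj₁ o<x  = ≤-trans (countIn-≥ c (suc o) L x o<x (subst (x <_) (+-suc o L) x<o+L)) (m≤n+m _ _)

C-pos : ∀ x k → k ≤ x → 0 < x C k
C-pos x       zero    _         = s≤s z≤n
C-pos (suc x) (suc k) (s≤s k≤x) = subst (0 <_) (nCk+nC[k+1]≡[n+1]C[k+1] x k) (<-≤-trans (C-pos x k k≤x) (m≤m+n _ _))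

∑-1 : ∀ k → ∑[ i < k ] 1 ≡ k
∑-1 zero    = refl
∑-1 (suc k) = cong suc (∑-1 k)

alternating-total : ∀ s → 1 ≤ s → s ≤ 4 → 1 + s C 2 + s C 4 ≡ s C 1 + s C 3
alternating-total 1 _ _ = refl
alternating-total 2 _ _ = refl
alternating-total 3 _ _ = refl
alternating-total 4 _ _ = refl
alternating-total (suc (suc (suc (suc (suc s))))) _ (s≤s (s≤s (s≤s (s≤s ()))))

lincomb : ∀ {x y X Y : ℕ} → X ≡ Y → x + Y ≡ y + X → x ≡ y
lincomb {x} {y} {X} X≡Y eq = +-cancelʳ-≡ X x y (trans (cong (x +_) X≡Y) eq)

≤-by-slack : ∀ {x y} z → x + z ≡ y → x ≤ y
≤-by-slack {x} z eq = subst (x ≤_) eq (m≤m+n x z)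

≤-summand : ∀ {b n} X Y → n ≡ X + Y → b ≤ X → b ≤ n
≤-summand X Y n≡ b≤X = ≤-trans b≤X (≤-by-slack Y (sym n≡))

-- m = 5 + k, and B = C(m − 3, 2) is kept abstract so that the ring solver treats it as a
-- variable; then C(m, 2) = B + 9 + 3k and (m + 1)(m − 2)/2 = B + 8 + 3k.
module Arithmetic (k B : ℕ) (B≡ : (2 + k) C 2 ≡ B) where

  B+B : B + B ≡ (2 + k) * (1 + k)
  B+B = subst (λ x → x + x ≡ (2 + k) * (1 + k)) B≡ (C2-double (1 + k))

  Combination : ℕ → Set
  Combination n = ∃[ α ] ∃[ β ] ∃[ γ ] ∃[ δ ] n ≡ α * (5 + k) + β * (6 + k) + γ * (B + 9 + 3 * k) + δ * (B + 8 + 3 * k)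

  combination-+ : ∀ {x y} → Combination x → Combination y → Combination (x + y)
  combination-+ (α , β , γ , δ , refl) (α′ , β′ , γ′ , δ′ , refl) =
    α + α′ , β + β′ , γ + γ′ , δ + δ′ , solve (α ∷ β ∷ γ ∷ δ ∷ α′ ∷ β′ ∷ γ′ ∷ δ′ ∷ k ∷ B ∷ [])

  combination-resp : ∀ x {y} → Combination y → x ≡ y → Combination x
  combination-resp _ y∈ refl = y∈

  multiples : ∀ α β → Combination (α * (5 + k) + β * (6 + k))
  multiples α β = α , β , 0 , 0 , solve (α ∷ β ∷ k ∷ B ∷ [])

  pairs∈ : Combination (B + 9 + 3 * k)
  pairs∈ = 0 , 0 , 1 , 0 , solve (k ∷ B ∷ [])

  half∈ : Combination (B + 8 + 3 * k)
  half∈ = 0 , 0 , 0 , 1 , solve (k ∷ B ∷ [])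

  finish₀ : ∀ {n} s₀ s₁ p₀ → n ≡ (5 + k) * s₀ + p₀ → s₀ ≡ p₀ + s₁ → Combination n
  finish₀ {n} s₀ s₁ p₀ n≡ refl = combination-resp n (multiples s₁ p₀) (trans n≡ (solve (s₁ ∷ p₀ ∷ k ∷ [])))

  finish₁ : ∀ {n} s₀ s₁ p₀ X → n ≡ (5 + k) * s₀ + p₀ + X → suc s₀ ≡ p₀ + s₁ →
    (p₀ ≡ 0 → Combination X) → Combination (suc X) → Combination n
  finish₁ {n} s₀ s₁ zero    X n≡ _  X∈ _ =
    combination-resp n (combination-+ (multiples s₀ 0) (X∈ refl)) (trans n≡ (solve (s₀ ∷ X ∷ k ∷ [])))
  finish₁ {n} s₀ s₁ (suc p) X n≡ eq _ X+1∈ with suc-injective eq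
  ... | refl = combination-resp n (combination-+ (multiples s₁ p) X+1∈) (trans n≡ (solve (s₁ ∷ p ∷ X ∷ k ∷ [])))

  impossible : ∀ {n} {P : Set} X Y → n < (5 + k) * (3 + k) → n ≡ X + Y → (5 + k) * (3 + k) ≤ X → P
  impossible X Y n< n≡ ≤X = contradiction (≤-summand X Y n≡ ≤X) (<⇒≱ n<)

  big-r : (5 + k) * (3 + k) ≤ k * k + 10 * k + 22
  big-r = ≤-by-slack (2 * k + 7) (solve (k ∷ []))

  big-q : (5 + k) * (3 + k) ≤ (B + 7 + 3 * k) + (B + 7 + 3 * k)
  big-q = ≤-by-slack (k + 1) (lincomb (sym B+B) (solve (k ∷ B ∷ [])))

  big-g : (5 + k) * (3 + k) ≤ (B + 13 + 4 * k) + (B + 13 + 4 * k)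
  big-g = ≤-by-slack (3 * k + 13) (lincomb (sym B+B) (solve (k ∷ B ∷ [])))

  big-qg : (5 + k) * (3 + k) ≤ (B + 7 + 3 * k) + (B + 13 + 4 * k)
  big-qg = ≤-by-slack (2 * k + 7) (lincomb (sym B+B) (solve (k ∷ B ∷ [])))

  sum≡1 : ∀ x y → x + y ≡ 1 → (x ≡ 0 × y ≡ 1) ⊎ (x ≡ 1 × y ≡ 0)
  sum≡1 0 y       eq = inj₁ (refl , eq)
  sum≡1 1 0       _  = inj₂ (refl , refl)

  case-g≡0 : ∀ {n} s₀ s₁ p₀ q t₂ t₄ → n < (5 + k) * (3 + k) → n ≡ (5 + k) * s₀ + p₀ + (B + 7 + 3 * k) * q + t₄ →
    t₂ + t₄ ≡ q → t₂ ≤ p₀ → q + s₀ ≡ p₀ + s₁ → Combination n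
  case-g≡0 s₀ s₁ p₀ (suc (suc q)) t₂ t₄ n< n≡ _ _ _ =
    impossible ((B + 7 + 3 * k) + (B + 7 + 3 * k)) ((5 + k) * s₀ + p₀ + (B + 7 + 3 * k) * q + t₄) n<
      (trans n≡ (solve (s₀ ∷ p₀ ∷ q ∷ t₄ ∷ k ∷ B ∷ []))) big-q
  case-g≡0 s₀ s₁ p₀ 0 t₂ t₄ n< n≡ t₂+t₄≡0 _ s₀≡ with m+n≡0⇒n≡0 t₂ t₂+t₄≡0
  ... | refl = finish₀ s₀ s₁ p₀ (trans n≡ (solve (s₀ ∷ p₀ ∷ k ∷ B ∷ []))) s₀≡
  case-g≡0 s₀ s₁ p₀ 1 t₂ t₄ n< n≡ t₂+t₄≡1 t₂≤p₀ s₀≡ with sum≡1 t₂ t₄ t₂+t₄≡1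
  ... | inj₁ (refl , refl) = finish₁ s₀ s₁ p₀ (B + 8 + 3 * k) (trans n≡ (solve (s₀ ∷ p₀ ∷ k ∷ B ∷ []))) s₀≡
          (λ _ → half∈) (combination-resp (suc (B + 8 + 3 * k)) pairs∈ (solve (k ∷ B ∷ [])))
  ... | inj₂ (refl , refl) = finish₁ s₀ s₁ p₀ (B + 7 + 3 * k) (trans n≡ (solve (s₀ ∷ p₀ ∷ k ∷ B ∷ []))) s₀≡
          (λ { refl → contradiction t₂≤p₀ λ () }) (combination-resp (suc (B + 7 + 3 * k)) half∈ (solve (k ∷ B ∷ [])))

  case-g≡1 : ∀ {n} s₀ s₁ p₀ q t₂ t₄ → n < (5 + k) * (3 + k) →
    n ≡ (5 + k) * s₀ + p₀ + (B + 7 + 3 * k) * q + (B + 13 + 4 * k) + t₄ →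
    t₂ + t₄ ≡ suc q → suc q + s₀ ≡ p₀ + s₁ → Combination n
  case-g≡1 s₀ s₁ p₀ (suc q) t₂ t₄ n< n≡ _ _ =
    impossible ((B + 7 + 3 * k) + (B + 13 + 4 * k)) ((5 + k) * s₀ + p₀ + (B + 7 + 3 * k) * q + t₄) n<
      (trans n≡ (solve (s₀ ∷ p₀ ∷ q ∷ t₄ ∷ k ∷ B ∷ []))) big-qg
  case-g≡1 s₀ s₁ p₀ 0 t₂ t₄ n< n≡ t₂+t₄≡1 s₀≡ with sum≡1 t₂ t₄ t₂+t₄≡1
  ... | inj₁ (refl , refl) = finish₁ s₀ s₁ p₀ (B + 13 + 4 * k + 1) (trans n≡ (solve (s₀ ∷ p₀ ∷ k ∷ B ∷ []))) s₀≡
          (λ _ → combination-resp (B + 13 + 4 * k + 1) (combination-+ (multiples 1 0) pairs∈) (solve (k ∷ B ∷ [])))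
          (combination-resp (suc (B + 13 + 4 * k + 1)) (combination-+ (multiples 0 1) pairs∈) (solve (k ∷ B ∷ [])))
  ... | inj₂ (refl , refl) = finish₁ s₀ s₁ p₀ (B + 13 + 4 * k) (trans n≡ (solve (s₀ ∷ p₀ ∷ k ∷ B ∷ []))) s₀≡
          (λ _ → combination-resp (B + 13 + 4 * k) (combination-+ (multiples 1 0) half∈) (solve (k ∷ B ∷ [])))
          (combination-resp (suc (B + 13 + 4 * k)) (combination-+ (multiples 1 0) pairs∈) (solve (k ∷ B ∷ [])))

  -- s₀, s₁, p₀, q, t₂, r, t₄, t₅ are the slacks in S₀, S₁, B₀, L₁, L₂, L₃, L₄, L₅ of Constraints
  conclude : ∀ {n} s₀ s₁ p₀ q r f g t₂ t₄ t₅ → n < (5 + k) * (3 + k) →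
    n ≡ (5 + k) * s₀ + p₀ + (B + 7 + 3 * k) * q + (k * k + 10 * k + 22) * r + (B + 13 + 4 * k) * g + t₄ →
    t₂ + t₄ ≡ 2 * r + g + q → 3 * g + k * g + (2 + k) * r + p₀ ≡ 2 * f + t₂ + t₅ →
    g + 2 * r + q + s₀ ≡ p₀ + s₁ → Combination n
  conclude s₀ s₁ p₀ q (suc r) f g t₂ t₄ t₅ n< n≡ _ _ _ =
    impossible (k * k + 10 * k + 22)
      ((5 + k) * s₀ + p₀ + (B + 7 + 3 * k) * q + (k * k + 10 * k + 22) * r + (B + 13 + 4 * k) * g + t₄) n<
      (trans n≡ (solve (k ∷ B ∷ s₀ ∷ p₀ ∷ q ∷ r ∷ g ∷ t₄ ∷ []))) big-r
  conclude s₀ s₁ p₀ q 0 f (suc (suc g)) t₂ t₄ t₅ n< n≡ _ _ _ =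
    impossible ((B + 13 + 4 * k) + (B + 13 + 4 * k)) ((5 + k) * s₀ + p₀ + (B + 7 + 3 * k) * q + (B + 13 + 4 * k) * g + t₄) n<
      (trans n≡ (solve (k ∷ B ∷ s₀ ∷ p₀ ∷ q ∷ g ∷ t₄ ∷ []))) big-g
  conclude s₀ s₁ p₀ q 0 f 0 t₂ t₄ t₅ n< n≡ eq-t eq-p eq-s =
    case-g≡0 s₀ s₁ p₀ q t₂ t₄ n< (trans n≡ (solve (k ∷ B ∷ s₀ ∷ p₀ ∷ q ∷ t₄ ∷ []))) eq-t t₂≤p₀ eq-s
    where
    t₂≤p₀ : t₂ ≤ p₀
    t₂≤p₀ = ≤-by-slack (2 * f + t₅) (begin
      t₂ + (2 * f + t₅)                     ≡⟨ solve (f ∷ t₂ ∷ t₅ ∷ []) ⟩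
      2 * f + t₂ + t₅                       ≡⟨ sym eq-p ⟩
      3 * 0 + k * 0 + (2 + k) * 0 + p₀      ≡⟨ solve (k ∷ p₀ ∷ []) ⟩
      p₀                                    ∎)
      where open ≡-Reasoning
  conclude s₀ s₁ p₀ q 0 f 1 t₂ t₄ t₅ n< n≡ eq-t _ eq-s =
    case-g≡1 s₀ s₁ p₀ q t₂ t₄ n< (trans n≡ (solve (k ∷ B ∷ s₀ ∷ p₀ ∷ q ∷ t₄ ∷ []))) eq-t eq-s

  record Constraints (n a b c d e f g : ℕ) : Set where
    field
      total : n + ((4 + k) * b + (3 + k + (2 + k + B)) * c) + ((2 + k) * f + B * g)
              ≡ (5 + k) * a + ((3 + k) * d + (2 + k + B) * (e + e))
      S₀ : b + (3 + k) * c + ((1 + k) * g + f) ≤ a + ((2 + k) * e + (d + (2 + k) * e))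
      S₁ : b + (2 + k) * c + b + (k * g + f) + ((1 + k) * g + f) ≤ a + ((1 + k) * e + (d + (1 + k) * e)) + (d + (2 + k) * e)
      B₀ : d + (2 + k) * e ≤ b + ((1 + k) * g + f)
      L₁ : 4 * e ≤ c + 4 * g
      L₂ : 2 * f ≤ d
      L₃ : 2 * g ≤ e
      L₄ : d + 2 * e ≤ c + (g + 2 * f)
      L₅ : 2 * d ≤ b + f

  combination : ∀ {n a b c d e f g} → n < (5 + k) * (3 + k) → Constraints n a b c d e f g → Combination n
  combination {n} {a} {b} {c} {d} {e} {f} {g} n< C
    with m≤n⇒∃[o]m+o≡n S₀ | m≤n⇒∃[o]m+o≡n S₁ | m≤n⇒∃[o]m+o≡n B₀ | m≤n⇒∃[o]m+o≡n L₁
       | m≤n⇒∃[o]m+o≡n L₂ | m≤n⇒∃[o]m+o≡n L₃ | m≤n⇒∃[o]m+o≡n L₄ | m≤n⇒∃[o]m+o≡n L₅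
    where open Constraints C
  ... | s₀ , S₀′ | s₁ , S₁′ | p₀ , B₀′ | q , L₁′ | t₂ , L₂′ | r , L₃′ | t₄ , L₄′ | t₅ , L₅′ =
    conclude s₀ s₁ p₀ q r f g t₂ t₄ t₅ n< n≡ eq-t eq-p eq-s
    where
    open Constraints C
    n≡ : n ≡ (5 + k) * s₀ + p₀ + (B + 7 + 3 * k) * q + (k * k + 10 * k + 22) * r + (B + 13 + 4 * k) * g + t₄
    n≡ = lincomb
      (cong₂ _+_ total (cong₂ _+_ (cong ((5 + k) *_) (sym S₀′)) (cong₂ _+_ (sym B₀′)
        (cong₂ _+_ (cong ((B + 7 + 3 * k) *_) (sym L₁′)) (cong₂ _+_ (cong ((k * k + 10 * k + 22) *_) (sym L₃′))
          (cong₂ _+_ (sym L₄′) (cong₂ _+_ (cong (3 * e *_) B+B) (cong ((c + 3 * g) *_) (sym B+B)))))))))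
      (solve (n ∷ a ∷ b ∷ c ∷ d ∷ e ∷ f ∷ g ∷ k ∷ B ∷ s₀ ∷ p₀ ∷ q ∷ r ∷ t₄ ∷ []))
    eq-t : t₂ + t₄ ≡ 2 * r + g + q
    eq-t = lincomb (cong₂ _+_ L₄′ (cong₂ _+_ (sym L₁′) (cong₂ _+_ (cong (2 *_) (sym L₃′)) L₂′)))
                (solve (c ∷ d ∷ e ∷ f ∷ g ∷ q ∷ r ∷ t₂ ∷ t₄ ∷ []))
    eq-p : 3 * g + k * g + (2 + k) * r + p₀ ≡ 2 * f + t₂ + t₅
    eq-p = lincomb (cong₂ _+_ B₀′ (cong₂ _+_ (cong ((2 + k) *_) L₃′) (cong₂ _+_ (sym L₅′) (sym L₂′))))
                (solve (b ∷ d ∷ e ∷ f ∷ g ∷ k ∷ p₀ ∷ r ∷ t₂ ∷ t₅ ∷ []))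
    eq-s : g + 2 * r + q + s₀ ≡ p₀ + s₁
    eq-s = lincomb (cong₂ _+_ S₀′ (cong₂ _+_ (sym S₁′) (cong₂ _+_ (sym B₀′) (cong₂ _+_ L₁′ (cong (2 *_) L₃′)))))
                (solve (a ∷ b ∷ c ∷ d ∷ e ∷ f ∷ g ∷ k ∷ s₀ ∷ s₁ ∷ p₀ ∷ q ∷ r ∷ []))

  pairs-eq : (5 + k) C 2 ≡ B + 9 + 3 * k
  pairs-eq = trans (suc-C2 (4 + k)) (trans (cong (4 + k +_) (trans (suc-C2 (3 + k)) (cong (3 + k +_)
               (trans (suc-C2 (2 + k)) (cong (2 + k +_) B≡))))) (solve (k ∷ B ∷ [])))

  half-eq : ((5 + k + 1) * (5 + k ∸ 2)) / 2 ≡ B + 8 + 3 * k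
  half-eq = trans (cong (_/ 2) double) (m*n/n≡m (B + 8 + 3 * k) 2)
    where
    double : (5 + k + 1) * (3 + k) ≡ (B + 8 + 3 * k) * 2
    double = lincomb (sym B+B) (solve (k ∷ B ∷ []))

  nonnegComb : ∀ {n} → Combination n → NonnegComb (5 + k) n
  nonnegComb (α , β , γ , δ , n≡) = α , β , γ , δ , trans n≡
    (cong₂ _+_ (cong₂ _+_ (cong (α * (5 + k) +_) (cong (β *_) (+-comm 1 (5 + k)))) (cong (γ *_) (sym pairs-eq)))
               (cong (δ *_) (sym half-eq)))

-- Intersection sizes of the set system

module Columns {n m : ℕ} (A : SetSystem n m) where

  col : Fin n → ℕ → Bool
  col u i with i <? m
  ... | yes i<m = lookup (A (fromℕ< i<m)) u
  ... | no  _   = false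

  col-toℕ : ∀ u i → col u (toℕ i) ≡ lookup (A i) u
  col-toℕ u i with toℕ i <? m
  ... | yes i<m = cong (λ j → lookup (A j) u) (fromℕ<-toℕ i i<m)
  ... | no  i≮m = contradiction (toℕ<n i) i≮m

  -- |H_I| for I the set of entries of t
  h : List ℕ → ℕ
  h t = ∑[ u < n ] bit (all (col u) t)

  windowSum : List ℕ → ℕ → ℕ → ℕ → ℕ
  windowSum p o L k = subsetSum (λ t → h (p ++ t)) o L k

  ∑-prefix : ∀ p o L k → ∑[ u < n ] (bit (all (col u) p) * (countIn (col u) o L C k)) ≡ windowSum p o L k
  ∑-prefix p o L k = trans (sym (sum-cong-≗ λ u → subsetSum-prefix (col u) p o L k))
                           (∑-subsetSum (λ u t → bit (all (col u) (p ++ t))) o L k)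

  ∑-choose : ∀ o L k → ∑[ u < n ] (countIn (col u) o L C k) ≡ windowSum [] o L k
  ∑-choose o L k = trans (sym (sum-cong-≗ λ u → subsetSum-all (col u) o L k))
                         (∑-subsetSum (λ u t → bit (all (col u) t)) o L k)

  windowSum-alternating₃ : ∀ p o L → (∀ u → all (col u) p ≡ true → countIn (col u) o L ≤ 3) →
    windowSum p o L 1 + windowSum p o L 3 ≤ windowSum p o L 0 + windowSum p o L 2
  windowSum-alternating₃ p o L bound = subst₂ _≤_ (∑-pair 1 3) (∑-pair 0 2)
    (∑-mono-≤ _ _ λ u → alternating₃ (all (col u) p) (countIn (col u) o L) (bound u))
    where
    X : ℕ → Fin n → ℕ
    X j u = bit (all (col u) p) * (countIn (col u) o L C j)
    ∑-pair : ∀ i j → ∑[ u < n ] (X i u + X j u) ≡ windowSum p o L i + windowSum p o L j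
    ∑-pair i j = trans (∑-distrib-+ (X i) (X j)) (cong₂ _+_ (∑-prefix p o L i) (∑-prefix p o L j))

  windowSum-alternating₂ : ∀ p o L → (∀ u → all (col u) p ≡ true → countIn (col u) o L ≤ 2) →
    windowSum p o L 1 ≤ windowSum p o L 0 + windowSum p o L 2
  windowSum-alternating₂ p o L bound = subst₂ _≤_ (∑-prefix p o L 1)
    (trans (∑-distrib-+ (X 0) (X 2)) (cong₂ _+_ (∑-prefix p o L 0) (∑-prefix p o L 2)))
    (∑-mono-≤ _ _ λ u → alternating₂ (all (col u) p) (countIn (col u) o L) (bound u))
    where
    X : ℕ → Fin n → ℕ
    X j u = bit (all (col u) p) * (countIn (col u) o L C j)

  -- inclusion–exclusion for the elements of H_p outside A_i
  windowSum-alternating-without : ∀ i p o L →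
    (∀ u → all (col u) p ≡ true → countIn (col u) o L ≤ 3) →
    (∀ u → all (col u) (i ∷ p) ≡ true → countIn (col u) o L ≤ 2) →
    windowSum p o L 1 + windowSum (i ∷ p) o L 0 + windowSum p o L 3 + windowSum (i ∷ p) o L 2
      ≤ windowSum p o L 0 + windowSum p o L 2 + windowSum (i ∷ p) o L 1
  windowSum-alternating-without i p o L bound bound′ = subst₂ _≤_
    (trans (∑-distrib-+ _ (Y 2)) (cong₂ _+_ (trans (∑-distrib-+ _ (X 3)) (cong₂ _+_
      (trans (∑-distrib-+ (X 1) (Y 0)) (cong₂ _+_ (∑-prefix p o L 1) (∑-prefix (i ∷ p) o L 0)))
      (∑-prefix p o L 3))) (∑-prefix (i ∷ p) o L 2)))
    (trans (∑-distrib-+ _ (Y 1)) (cong₂ _+_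
      (trans (∑-distrib-+ (X 0) (X 2)) (cong₂ _+_ (∑-prefix p o L 0) (∑-prefix p o L 2)))
      (∑-prefix (i ∷ p) o L 1)))
    (∑-mono-≤ _ _ λ u → alternating-without (all (col u) p) (col u i) (countIn (col u) o L) (bound u) (bound′ u))
    where
    X Y : ℕ → Fin n → ℕ
    X j u = bit (all (col u) p) * (countIn (col u) o L C j)
    Y j u = bit (all (col u) (i ∷ p)) * (countIn (col u) o L C j)

  ∈H⁺ : ∀ u I → (∀ i → i ∈ I → u ∈ A i) → u ∈ H A I
  ∈H⁺ u I u∈ = ∈⋂⁺ (map A (elems I))
    (All.map⁺ (All.tabulate (λ {i} i∈ → u∈ i (proj₂ (∈-filter⁻ (_∈? I) {xs = allFinL m} i∈)))))

  ∈H⁻ : ∀ u I → u ∈ H A I → ∀ i → i ∈ I → u ∈ A i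
  ∈H⁻ u I u∈ i i∈ = All.lookup (All.map⁻ (∈⋂⁻ (map A (elems I)) u∈)) (∈-filter⁺ (_∈? I) (∈-allFin i) i∈)

  lookup-H-vecOf : ∀ l → length l ≡ m → ∀ u → lookup (H A (vecOf l)) u ≡ allOn (col u) l 0
  lookup-H-vecOf l len u = ⇔→≡ {z = true} (mk⇔ to from)
    where
    to : lookup (H A (vecOf l)) u ≡ true → allOn (col u) l 0 ≡ true
    to u∈H = ⇒allOn (col u) l 0 λ j lj →
      let j<m = subst (j <_) len (at-< l j lj)
          i   = fromℕ< j<m
          i∈  = ∈vecOf⁺ l i (subst (λ k → at l k ≡ true) (sym (toℕ-fromℕ< j<m)) lj)
      in subst (λ k → col u k ≡ true) (toℕ-fromℕ< j<m)
           (trans (col-toℕ u i) ([]=⇒lookup (∈H⁻ u (vecOf l) (lookup⇒[]= u _ u∈H) i i∈)))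
    from : allOn (col u) l 0 ≡ true → lookup (H A (vecOf l)) u ≡ true
    from ok = []=⇒lookup (∈H⁺ u (vecOf l) λ i i∈ →
      lookup⇒[]= u _ (trans (sym (col-toℕ u i)) (allOn⇒ (col u) l 0 ok (toℕ i) (∈vecOf⁻ l i i∈))))

  ∣H-word∣ : ∀ x gs r → length (word x gs r) ≡ m → ∣ H A (vecOf (word x gs r)) ∣ ≡ h (positions x gs)
  ∣H-word∣ x gs r len = trans (∣∣≡∑ (H A (vecOf (word x gs r))))
    (sum-cong-≗ λ u → cong bit (trans (lookup-H-vecOf (word x gs r) len u) (allOn-word (col u) x gs r 0)))

  runDecomposition-word : ∀ x gs r → length (word x gs r) ≡ m →
    runDecomposition (vecOf {m} (word x gs r)) ≡ reverse (sort (runsAfter 0 gs))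
  runDecomposition-word x gs r len = cong (reverse ∘ sort)
    (trans (cong (runsAux 0) (subst (λ k → toList (vecOf {k} (word x gs r)) ≡ word x gs r) len (toList-vecOf (word x gs r))))
           (runsAux-word x gs r))

module Harmonicity {n m : ℕ} {A : SetSystem n m} (harm : Harmonic A) where

  open Columns A

  padding : ∀ x gs → lastPosition x gs < m → ∃[ r ] length (word x gs r) ≡ m
  padding x gs last<m = let r , eq = m≤n⇒∃[o]m+o≡n last<m in r , trans (length-word 0 x gs r) eq

  h-runs : ∀ x gs x′ gs′ → lastPosition x gs < m → lastPosition x′ gs′ < m →
    reverse (sort (runsAfter 0 gs)) ≡ reverse (sort (runsAfter 0 gs′)) → h (positions x gs) ≡ h (positions x′ gs′)
  h-runs x gs x′ gs′ last<m last′<m same-runs with padding x gs last<m | padding x′ gs′ last′<m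
  ... | r , len | r′ , len′ = begin
    h (positions x gs)             ≡⟨ sym (∣H-word∣ x gs r len) ⟩
    ∣ H A (vecOf (word x gs r)) ∣   ≡⟨ harm _ _ (trans (runDecomposition-word x gs r len)
                                            (trans same-runs (sym (runDecomposition-word x′ gs′ r′ len′)))) ⟩
    ∣ H A (vecOf (word x′ gs′ r′)) ∣ ≡⟨ ∣H-word∣ x′ gs′ r′ len′ ⟩
    h (positions x′ gs′)           ∎
    where open ≡-Reasoning

  h-canonical : ∀ x gs → lastPosition x gs < m → h (positions x gs) ≡ h (positions 0 (compress gs))
  h-canonical x gs last<m = h-runs x gs 0 (compress gs) last<m (compress-< gs last<m)
    (cong (reverse ∘ sort) (sym (runsAfter-compress 0 gs)))

  -- h on the run decompositions 1, 2, 11, 3, 21, 4, 22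
  a b c d e f g : ℕ
  a = h (0 ∷ [])
  b = h (0 ∷ 1 ∷ [])
  c = h (0 ∷ 2 ∷ [])
  d = h (0 ∷ 1 ∷ 2 ∷ [])
  e = h (0 ∷ 1 ∷ 3 ∷ [])
  f = h (0 ∷ 1 ∷ 2 ∷ 3 ∷ [])
  g = h (0 ∷ 1 ∷ 3 ∷ 4 ∷ [])

  h-single : ∀ {x} → x < m → h (x ∷ []) ≡ a
  h-single {x} = h-canonical x []

  h-adjacent : ∀ {x} → suc x < m → h (x ∷ suc x ∷ []) ≡ b
  h-adjacent {x} = h-canonical x (0 ∷ [])

  h-apart : ∀ {x y} → suc x < y → y < m → h (x ∷ y ∷ []) ≡ c
  h-apart {x} x+1<y with gap x+1<y
  ... | w , refl = h-canonical x (suc w ∷ [])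

  h-run₃ : ∀ {x} → suc (suc x) < m → h (x ∷ suc x ∷ suc (suc x) ∷ []) ≡ d
  h-run₃ {x} = h-canonical x (0 ∷ 0 ∷ [])

  h-run₂₁ : ∀ {x z} → suc (suc x) < z → z < m → h (x ∷ suc x ∷ z ∷ []) ≡ e
  h-run₂₁ {x} x+2<z with gap x+2<z
  ... | w , refl = h-canonical x (0 ∷ suc w ∷ [])

  h-run₁₂ : ∀ {x y} → suc x < y → suc y < m → h (x ∷ y ∷ suc y ∷ []) ≡ e
  h-run₁₂ {x} x+1<y y+1<m with gap x+1<y
  ... | w , refl = trans (h-canonical x (suc w ∷ 0 ∷ []) y+1<m)
                         (h-runs 0 (1 ∷ 0 ∷ []) 0 (0 ∷ 1 ∷ []) 3<m 3<m refl)
    where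
    3<m : 3 < m
    3<m = compress-< (suc w ∷ 0 ∷ []) y+1<m

  h-run₄ : ∀ {x} → suc (suc (suc x)) < m → h (x ∷ suc x ∷ suc (suc x) ∷ suc (suc (suc x)) ∷ []) ≡ f
  h-run₄ {x} = h-canonical x (0 ∷ 0 ∷ 0 ∷ [])

  h-run₂₂ : ∀ {x z} → suc (suc x) < z → suc z < m → h (x ∷ suc x ∷ z ∷ suc z ∷ []) ≡ g
  h-run₂₂ {x} x+2<z with gap x+2<z
  ... | w , refl = h-canonical x (0 ∷ suc w ∷ 0 ∷ [])

module SpreadTriples {n m : ℕ} {A : SetSystem n m} (harm : Harmonic A)
  (spread-empty : (I : Subset m) → Nonconsecutive I → ∣ I ∣ ≡ 3 → H A I ≡ ⊥) where

  open Columns A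
  open Harmonicity harm

  h-spread₀ : 4 < m → h (0 ∷ 2 ∷ 4 ∷ []) ≡ 0
  h-spread₀ 4<m with padding 0 (1 ∷ 1 ∷ []) 4<m
  ... | r , len = begin
    h (0 ∷ 2 ∷ 4 ∷ [])  ≡⟨ sym (∣H-word∣ 0 (1 ∷ 1 ∷ []) r len) ⟩
    ∣ H A I₀ ∣          ≡⟨ cong ∣_∣ (spread-empty I₀ spread three) ⟩
    ∣ ⊥ {n = n} ∣       ≡⟨ ∣⊥∣≡0 n ⟩
    0                   ∎
    where
    open ≡-Reasoning
    l : List Bool
    l = word 0 (1 ∷ 1 ∷ []) r
    I₀ : Subset m
    I₀ = vecOf l
    no-adjacent : ∀ p → at l p ≡ true → at l (suc p) ≢ true
    no-adjacent 0 _ ()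
    no-adjacent 1 () _
    no-adjacent 2 _ ()
    no-adjacent 3 () _
    no-adjacent (suc (suc (suc (suc q)))) _ lq = contradiction (trans (sym lq) (at-falses r q)) λ ()
    spread : Nonconsecutive I₀
    spread i j i∈ j∈ i≡j+1 =
      no-adjacent (toℕ j) (∈vecOf⁻ l j j∈) (subst (λ p → at l p ≡ true) i≡j+1 (∈vecOf⁻ l i i∈))
    three : ∣ I₀ ∣ ≡ 3
    three = subst (λ k → ∣ vecOf {k} l ∣ ≡ 3) len (cong (3 +_) (∣vecOf-falses∣ r))

  h-spread : ∀ {x y z} → suc x < y → suc y < z → z < m → h (x ∷ y ∷ z ∷ []) ≡ 0
  h-spread {x} x+1<y y+1<z z<m with gap x+1<y
  ... | w , refl with gap y+1<z
  ...   | v , refl = trans (h-canonical x (suc w ∷ suc v ∷ []) z<m) (h-spread₀ (compress-< (suc w ∷ suc v ∷ []) z<m))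

  h-drop : ∀ t₁ y t₂ → h (t₁ ++ y ∷ t₂) ≤ h (t₁ ++ t₂)
  h-drop t₁ y t₂ = ∑-mono-≤ _ _ (λ u → bit-all-drop (col u) t₁ y t₂)

  h-⊇-spread : ∀ t {x y z} → h t ≤ h (x ∷ y ∷ z ∷ []) → suc x < y → suc y < z → z < m → h t ≡ 0
  h-⊇-spread _ t≤ x+1<y y+1<z z<m = n≤0⇒n≡0 (≤-trans t≤ (≤-reflexive (h-spread x+1<y y+1<z z<m)))

  singletons : ∀ o L → o + L ≤ m → windowSum [] o L 1 ≡ L * a
  singletons o L le = subsetSum-singletons a m o L le (λ x _ → h-single)

  pairsFrom : ∀ o L → suc o + suc L ≤ m → windowSum (o ∷ []) (suc o) (suc L) 1 ≡ b + L * c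
  pairsFrom o L le = begin
    windowSum (o ∷ []) (suc (suc o)) L 1 + h (o ∷ suc o ∷ [])
      ≡⟨ cong₂ _+_ (subsetSum-singletons c m (suc (suc o)) L le′ (λ _ → h-apart))
                   (h-adjacent (<-≤-trans (s≤s (s≤s (m≤m+n o L))) le′)) ⟩
    L * c + b                                                ≡⟨ +-comm (L * c) b ⟩
    b + L * c                                                ∎
    where
    open ≡-Reasoning
    le′ : suc (suc o) + L ≤ m
    le′ = subst (_≤ m) (+-suc (suc o) L) le

  triplesFromRun : ∀ o L → suc (suc o) + suc L ≤ m → windowSum (o ∷ suc o ∷ []) (suc (suc o)) (suc L) 1 ≡ d + L * e
  triplesFromRun o L le = begin
    windowSum (o ∷ suc o ∷ []) (3 + o) L 1 + h (o ∷ suc o ∷ suc (suc o) ∷ [])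
      ≡⟨ cong₂ _+_ (subsetSum-singletons e m (3 + o) L le′ (λ _ → h-run₂₁))
                   (h-run₃ (<-≤-trans (s≤s (s≤s (s≤s (m≤m+n o L)))) le′)) ⟩
    L * e + d ≡⟨ +-comm (L * e) d ⟩
    d + L * e ∎
    where
    open ≡-Reasoning
    le′ : 3 + o + L ≤ m
    le′ = subst (_≤ m) (+-suc (2 + o) L) le

  triplesFrom : ∀ o L → suc o + suc (suc L) ≤ m → windowSum (o ∷ []) (suc o) (suc (suc L)) 2 ≡ L * e + (d + L * e)
  triplesFrom o L le = cong₂ _+_
    (subsetSum-pairs e m (2 + o) L le′ (λ _ → h-run₁₂) (λ _ _ → h-spread))
    (triplesFromRun o L le′)
    where
    le′ : 2 + o + suc L ≤ m
    le′ = subst (_≤ m) (+-suc (suc o) (suc L)) le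

  quadruplesFromRun : ∀ o L → suc (suc o) + suc (suc L) ≤ m →
    windowSum (o ∷ suc o ∷ []) (suc (suc o)) (suc (suc L)) 2 ≡ L * g + f
  quadruplesFromRun o L le = begin
    windowSum (o ∷ suc o ∷ []) (3 + o) (suc L) 2
      + (windowSum (o ∷ suc o ∷ suc (suc o) ∷ []) (4 + o) L 1 + h (o ∷ suc o ∷ suc (suc o) ∷ suc (suc (suc o)) ∷ []))
      ≡⟨ cong₂ _+_ (subsetSum-pairs g m (3 + o) L le′ (λ _ → h-run₂₂) spread)
                   (cong₂ _+_ (subsetSum-singletons 0 m (4 + o) L le″ spread′)
                              (h-run₄ (<-≤-trans (s≤s (s≤s (s≤s (s≤s (m≤m+n o L))))) le″))) ⟩
    L * g + (L * 0 + f) ≡⟨ cong (λ k → L * g + (k + f)) (*-zeroʳ L) ⟩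
    L * g + f ∎
    where
    open ≡-Reasoning
    le′ : 3 + o + suc L ≤ m
    le′ = subst (_≤ m) (+-suc (2 + o) (suc L)) le
    le″ : 4 + o + L ≤ m
    le″ = subst (_≤ m) (+-suc (3 + o) L) le′
    spread : ∀ y z → 3 + o ≤ y → suc y < z → z < m → h (o ∷ suc o ∷ y ∷ z ∷ []) ≡ 0
    spread y z o+2<y = h-⊇-spread (o ∷ suc o ∷ y ∷ z ∷ []) (h-drop (o ∷ []) (suc o) (y ∷ z ∷ [])) (<-trans (n<1+n _) o+2<y)
    spread′ : ∀ z → 4 + o ≤ z → z < m → h (o ∷ suc o ∷ suc (suc o) ∷ z ∷ []) ≡ 0
    spread′ z = h-⊇-spread (o ∷ suc o ∷ suc (suc o) ∷ z ∷ []) (h-drop (o ∷ []) (suc o) (suc (suc o) ∷ z ∷ [])) ≤-refl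

  quadruplesFrom : ∀ o L → suc o + suc (suc (suc L)) ≤ m →
    windowSum (o ∷ []) (suc o) (suc (suc (suc L))) 3 ≡ L * g + f
  quadruplesFrom o L le = cong₂ _+_ (subsetSum-vanishing m (2 + o) (suc (suc L)) 3 le′ spread) (quadruplesFromRun o L le′)
    where
    le′ : 2 + o + suc (suc L) ≤ m
    le′ = subst (_≤ m) (+-suc (suc o) (suc (suc L))) le
    spread : ∀ t → Inside m (2 + o) t → length t ≡ 3 → h (o ∷ t) ≡ 0
    spread (x ∷ y ∷ z ∷ []) (o+2≤x , _ , x<y , _ , y<z , z<m , _) _ =
      h-⊇-spread (o ∷ x ∷ y ∷ z ∷ []) (h-drop (o ∷ x ∷ []) y (z ∷ [])) o+2≤x (<-≤-trans (s≤s x<y) y<z) z<m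

  pairs : ∀ o L → o + suc L ≤ m → windowSum [] o (suc L) 2 ≡ L * b + (L C 2) * c
  pairs o zero    _  = refl
  pairs o (suc L) le = begin
    windowSum [] (suc o) (suc L) 2 + windowSum (o ∷ []) (suc o) (suc L) 1
      ≡⟨ cong₂ _+_ (pairs (suc o) L le′) (pairsFrom o L le′) ⟩
    L * b + (L C 2) * c + (b + L * c)   ≡⟨ rearrange L b c (L C 2) ⟩
    suc L * b + (L + L C 2) * c      ≡⟨ cong (λ k → suc L * b + k * c) (sym (suc-C2 L)) ⟩
    suc L * b + (suc L C 2) * c        ∎
    where
    open ≡-Reasoning
    le′ : suc o + suc L ≤ m
    le′ = subst (_≤ m) (+-suc o (suc L)) le
    rearrange : ∀ L b c B → L * b + B * c + (b + L * c) ≡ suc L * b + (L + B) * c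
    rearrange = solve-∀

  triples : ∀ o L → o + suc (suc L) ≤ m → windowSum [] o (suc (suc L)) 3 ≡ L * d + (L C 2) * (e + e)
  triples o zero    _  = refl
  triples o (suc L) le = begin
    windowSum [] (suc o) (suc (suc L)) 3 + windowSum (o ∷ []) (suc o) (suc (suc L)) 2
      ≡⟨ cong₂ _+_ (triples (suc o) L le′) (triplesFrom o L le′) ⟩
    L * d + (L C 2) * (e + e) + (L * e + (d + L * e)) ≡⟨ rearrange L d e (L C 2) ⟩
    suc L * d + (L + L C 2) * (e + e)            ≡⟨ cong (λ k → suc L * d + k * (e + e)) (sym (suc-C2 L)) ⟩
    suc L * d + (suc L C 2) * (e + e)              ∎
    where
    open ≡-Reasoning
    le′ : suc o + suc (suc L) ≤ m
    le′ = subst (_≤ m) (+-suc o (suc (suc L))) le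
    rearrange : ∀ L d e B → L * d + B * (e + e) + (L * e + (d + L * e)) ≡ suc L * d + (L + B) * (e + e)
    rearrange = solve-∀

  quadruples : ∀ o L → o + suc (suc (suc L)) ≤ m → windowSum [] o (suc (suc (suc L))) 4 ≡ L * f + (L C 2) * g
  quadruples o zero    _  = refl
  quadruples o (suc L) le = begin
    windowSum [] (suc o) (suc (suc (suc L))) 4 + windowSum (o ∷ []) (suc o) (suc (suc (suc L))) 3
      ≡⟨ cong₂ _+_ (quadruples (suc o) L le′) (quadruplesFrom o L le′) ⟩
    L * f + (L C 2) * g + (L * g + f) ≡⟨ rearrange L f g (L C 2) ⟩
    suc L * f + (L + L C 2) * g    ≡⟨ cong (λ k → suc L * f + k * g) (sym (suc-C2 L)) ⟩
    suc L * f + (suc L C 2) * g      ∎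
    where
    open ≡-Reasoning
    le′ : suc o + suc (suc (suc L)) ≤ m
    le′ = subst (_≤ m) (+-suc o (suc (suc (suc L)))) le
    rearrange : ∀ L f g B → L * f + B * g + (L * g + f) ≡ suc L * f + (L + B) * g
    rearrange = solve-∀

  quintuples : ∀ o L → o + L ≤ m → windowSum [] o L 5 ≡ 0
  quintuples o L le = subsetSum-vanishing m o L 5 le spread
    where
    spread : ∀ t → Inside m o t → length t ≡ 5 → h t ≡ 0
    spread (x₁ ∷ x₂ ∷ x₃ ∷ x₄ ∷ x₅ ∷ []) (_ , _ , x₁<x₂ , _ , x₂<x₃ , _ , x₃<x₄ , _ , x₄<x₅ , x₅<m , _) _ =
      h-⊇-spread (x₁ ∷ x₂ ∷ x₃ ∷ x₄ ∷ x₅ ∷ [])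
        (≤-trans (h-drop (x₁ ∷ []) x₂ (x₃ ∷ x₄ ∷ x₅ ∷ [])) (h-drop (x₁ ∷ x₃ ∷ []) x₄ (x₅ ∷ [])))
                 (<-≤-trans (s≤s x₁<x₂) x₂<x₃) (<-≤-trans (s≤s x₃<x₄) x₄<x₅) x₅<m

  h-same-runs : ∀ x r x′ r′ → InWindow m (x ∷ r) → InWindow m (x′ ∷ r′) →
    runDecompositionOf (x ∷ r) ≡ runDecompositionOf (x′ ∷ r′) → h (x ∷ r) ≡ h (x′ ∷ r′)
  h-same-runs x r x′ r′ (lnk , <m) (lnk′ , <m′) same =
    subst₂ (λ p p′ → h p ≡ h p′) (positions-gapsFrom x r lnk) (positions-gapsFrom x′ r′ lnk′)
      (h-runs x (gapsFrom x r) x′ (gapsFrom x′ r′) (lastPosition-gapsFrom x r lnk <m) (lastPosition-gapsFrom x′ r′ lnk′ <m′) same)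

  h-canonicalᵃ : ∀ {w} t → w ≤ m → Admissible w t → h t ≡ h (canonical t)
  h-canonicalᵃ []      _   (_ , _ , ())
  h-canonicalᵃ (x ∷ r) w≤m ((lnk , <w) , (lnk′ , <w′) , same) =
    h-same-runs x r 0 _ (lnk , All.map widen <w) (lnk′ , All.map widen <w′) same
    where
    widen : ∀ {i} → i < _ → i < m
    widen i<w = <-≤-trans i<w w≤m

  h-spread-admissible : ∀ {w} z → w ≤ m → Spread w z → h z ≡ 0
  h-spread-admissible z w≤m (adm@(_ , (_ , c<w) , _) , z₀) with subst (All (_< _)) z₀ c<w
  ... | _ All.∷ _ All.∷ 4<w All.∷ All.[] = begin
    h z                 ≡⟨ h-canonicalᵃ z w≤m adm ⟩
    h (canonical z)     ≡⟨ cong h z₀ ⟩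
    h (0 ∷ 2 ∷ 4 ∷ [])  ≡⟨ h-spread₀ (<-≤-trans 4<w w≤m) ⟩
    0                   ∎
    where open ≡-Reasoning

  ∑-ones : ∀ ts → ∑[ u < n ] ones (map (all (col u)) ts) ≡ sum (map h ts)
  ∑-ones []       = sum-replicate-zero n
  ∑-ones (t ∷ ts) = trans (∑-distrib-+ (λ u → bit (all (col u) t)) (λ u → ones (map (all (col u)) ts)))
                          (cong (h t +_) (∑-ones ts))

  -- A linear inequality between the |H_I| follows from the same inequality for every single
  -- column; a column only matters on [0, w), so the latter is decided by enumerating 2^w columns.
  local-inequality : ∀ w → w ≤ m → ∀ zs ls rs →
    {_ : True (All.all? (spread? w) zs)} → {_ : True (All.all? (admissible? w) (ls ++ rs))} →
    {_ : T (allBits w (λ v → holds (at v) zs ls rs))} →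
    sum (map (h ∘ canonical) ls) ≤ sum (map (h ∘ canonical) rs)
  local-inequality w w≤m zs ls rs {spread} {adm} {checked} = begin
    sum (map (h ∘ canonical) ls)               ≡⟨ sym (sum-canonical ls adm-ls) ⟩
    sum (map h ls)                             ≡⟨ sym (∑-ones ls) ⟩
    ∑[ u < n ] ones (map (all (col u)) ls)     ≤⟨ ∑-mono-≤ _ _ column ⟩
    ∑[ u < n ] ones (map (all (col u)) rs)     ≡⟨ ∑-ones rs ⟩
    sum (map h rs)                             ≡⟨ sum-canonical rs adm-rs ⟩
    sum (map (h ∘ canonical) rs)               ∎
    where
    open ≤-Reasoning
    zs-spread : All (Spread w) zs
    zs-spread = toWitness spread
    adm-ls : All (Admissible w) ls
    adm-ls = proj₁ (All.++⁻ ls (toWitness adm))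
    adm-rs : All (Admissible w) rs
    adm-rs = proj₂ (All.++⁻ ls (toWitness adm))
    sum-canonical : ∀ ts → All (Admissible w) ts → sum (map h ts) ≡ sum (map (h ∘ canonical) ts)
    sum-canonical []       All.[]       = refl
    sum-canonical (t ∷ ts) (a All.∷ as) = cong₂ _+_ (h-canonicalᵃ t w≤m a) (sum-canonical ts as)
    inside : All (All (_< w)) (zs ++ ls ++ rs)
    inside = All.++⁺ (All.map (proj₂ ∘ proj₁ ∘ proj₁) zs-spread) (All.map (proj₂ ∘ proj₁) (toWitness adm))
    misses : ∀ u → All (λ z → all (col u) z ≡ false) zs
    misses u = All.map (λ {z} sp → bit≡0⇒ (∑≡0⇒ (λ u → bit (all (col u) z)) (h-spread-admissible z w≤m sp) u)) zs-spread
    column : ∀ u → ones (map (all (col u)) ls) ≤ ones (map (all (col u)) rs)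
    column u = holds-sound (col u) zs ls rs
      (subst T (holds-window (col u) w zs ls rs inside) (allBits-window w (λ v → holds (at v) zs ls rs) checked (col u)))
      (misses u)

module Bounds (k : ℕ) (2≤k : 2 ≤ k) {n : ℕ} {A : SetSystem n (5 + k)} (complete : Complete A) (harm : Harmonic A)
  (spread-empty : (I : Subset (5 + k)) → Nonconsecutive I → ∣ I ∣ ≡ 3 → H A I ≡ ⊥) where

  open Columns A
  open Harmonicity harm
  open SpreadTriples harm spread-empty

  degree : Fin n → ℕ
  degree u = countIn (col u) 0 (5 + k)

  degree≥1 : ∀ u → 1 ≤ degree u
  degree≥1 u with complete u
  ... | i , u∈Aᵢ = subst (_≤ degree u) (cong bit (trans (col-toℕ u i) ([]=⇒lookup u∈Aᵢ)))
                         (countIn-≥ (col u) 0 (5 + k) (toℕ i) z≤n (toℕ<n i))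

  degree≤4 : ∀ u → degree u ≤ 4
  degree≤4 u with degree u ≤? 4
  ... | yes ≤4 = ≤4
  ... | no  ≰4 = contradiction (∑≡0⇒ (λ u → degree u C 5) (trans (∑-choose 0 (5 + k) 5) (quintuples 0 (5 + k) ≤-refl)) u)
                               (≢-sym (<⇒≢ (C-pos (degree u) 5 (≰⇒> ≰4))))

  total : n + ((4 + k) * b + ((4 + k) C 2) * c) + ((2 + k) * f + ((2 + k) C 2) * g)
          ≡ (5 + k) * a + ((3 + k) * d + ((3 + k) C 2) * (e + e))
  total = begin
    n + ((4 + k) * b + ((4 + k) C 2) * c) + ((2 + k) * f + ((2 + k) C 2) * g)
      ≡⟨ sym (cong₂ _+_ (cong₂ _+_ (∑-1 n) (∑C 2 (pairs 0 (4 + k) ≤-refl))) (∑C 4 (quadruples 0 (2 + k) ≤-refl))) ⟩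
    ∑[ u < n ] 1 + ∑[ u < n ] (degree u C 2) + ∑[ u < n ] (degree u C 4)
      ≡⟨ sym (trans (∑-distrib-+ (λ u → 1 + degree u C 2) (λ u → degree u C 4))
                    (cong (_+ ∑[ u < n ] (degree u C 4)) (∑-distrib-+ (λ _ → 1) (λ u → degree u C 2)))) ⟩
    ∑[ u < n ] (1 + degree u C 2 + degree u C 4)
      ≡⟨ sum-cong-≗ (λ u → alternating-total (degree u) (degree≥1 u) (degree≤4 u)) ⟩
    ∑[ u < n ] (degree u C 1 + degree u C 3)
      ≡⟨ ∑-distrib-+ (λ u → degree u C 1) (λ u → degree u C 3) ⟩
    ∑[ u < n ] (degree u C 1) + ∑[ u < n ] (degree u C 3)
      ≡⟨ cong₂ _+_ (∑C 1 (singletons 0 (5 + k) ≤-refl)) (∑C 3 (triples 0 (3 + k) ≤-refl)) ⟩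
    (5 + k) * a + ((3 + k) * d + ((3 + k) C 2) * (e + e)) ∎
    where
    open ≡-Reasoning
    ∑C : ∀ j {v} → windowSum [] 0 (5 + k) j ≡ v → ∑[ u < n ] (degree u C j) ≡ v
    ∑C j = trans (∑-choose 0 (5 + k) j)

  bound₀ : ∀ u → all (col u) (0 ∷ []) ≡ true → countIn (col u) 1 (4 + k) ≤ 3
  bound₀ u c₀ = ≤-pred (subst (λ x → bit x + countIn (col u) 1 (4 + k) ≤ 4) (∧-conicalˡ (col u 0) true c₀) (degree≤4 u))

  bound₁ : ∀ u → all (col u) (1 ∷ []) ≡ true → countIn (col u) 2 (3 + k) ≤ 3
  bound₁ u c₁ = ≤-pred (≤-trans (m≤n+m _ (bit (col u 0)))
    (subst (λ x → bit (col u 0) + (bit x + countIn (col u) 2 (3 + k)) ≤ 4) (∧-conicalˡ (col u 1) true c₁) (degree≤4 u)))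

  bound₀₁ : ∀ u → all (col u) (0 ∷ 1 ∷ []) ≡ true → countIn (col u) 2 (3 + k) ≤ 2
  bound₀₁ u c₀₁ = ≤-pred (≤-pred (subst₂ (λ x y → bit x + (bit y + countIn (col u) 2 (3 + k)) ≤ 4)
    (∧-conicalˡ (col u 0) _ c₀₁) (∧-conicalˡ (col u 1) true (∧-conicalʳ (col u 0) _ c₀₁)) (degree≤4 u)))

  S₀ : b + (3 + k) * c + ((1 + k) * g + f) ≤ a + ((2 + k) * e + (d + (2 + k) * e))
  S₀ = subst₂ _≤_ (cong₂ _+_ (pairsFrom 0 (3 + k) ≤-refl) (quadruplesFrom 0 (1 + k) ≤-refl))
                  (cong (a +_) (triplesFrom 0 (2 + k) ≤-refl))
                  (windowSum-alternating₃ (0 ∷ []) 1 (4 + k) bound₀)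

  S₁ : b + (2 + k) * c + b + (k * g + f) + ((1 + k) * g + f) ≤ a + ((1 + k) * e + (d + (1 + k) * e)) + (d + (2 + k) * e)
  S₁ = subst₂ _≤_
    (cong₂ _+_ (cong₂ _+_ (cong (_+ b) (pairsFrom 1 (2 + k) ≤-refl)) (quadruplesFrom 1 k ≤-refl))
               (quadruplesFromRun 0 (1 + k) ≤-refl))
    (cong₂ _+_ (cong₂ _+_ (h-single (s≤s (s≤s z≤n))) (triplesFrom 1 (1 + k) ≤-refl)) (triplesFromRun 0 (2 + k) ≤-refl))
    (windowSum-alternating-without 0 (1 ∷ []) 2 (3 + k) bound₁ bound₀₁)

  B₀ : d + (2 + k) * e ≤ b + ((1 + k) * g + f)
  B₀ = subst₂ _≤_ (triplesFromRun 0 (2 + k) ≤-refl) (cong (b +_) (quadruplesFromRun 0 (1 + k) ≤-refl))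
                  (windowSum-alternating₂ (0 ∷ 1 ∷ []) 2 (3 + k) bound₀₁)

  7≤m : 7 ≤ 5 + k
  7≤m = +-monoʳ-≤ 5 2≤k

  L₁ : 4 * e ≤ c + 4 * g
  L₁ = local-inequality 7 7≤m
    ((0 ∷ 2 ∷ 5 ∷ []) ∷ (1 ∷ 4 ∷ 6 ∷ []) ∷ [])
    ((0 ∷ 1 ∷ 5 ∷ []) ∷ (1 ∷ 2 ∷ 5 ∷ []) ∷ (1 ∷ 4 ∷ 5 ∷ []) ∷ (1 ∷ 5 ∷ 6 ∷ []) ∷ [])
    ((1 ∷ 5 ∷ []) ∷ (0 ∷ 1 ∷ 4 ∷ 5 ∷ []) ∷ (0 ∷ 1 ∷ 5 ∷ 6 ∷ [])
      ∷ (1 ∷ 2 ∷ 4 ∷ 5 ∷ []) ∷ (1 ∷ 2 ∷ 5 ∷ 6 ∷ []) ∷ [])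

  L₂ : 2 * f ≤ d
  L₂ = subst (2 * f ≤_) (+-identityʳ d) (local-inequality 7 7≤m
    ((0 ∷ 2 ∷ 4 ∷ []) ∷ [])
    ((0 ∷ 1 ∷ 2 ∷ 3 ∷ []) ∷ (1 ∷ 2 ∷ 3 ∷ 4 ∷ []) ∷ [])
    ((1 ∷ 2 ∷ 3 ∷ []) ∷ []))

  L₃ : 2 * g ≤ e
  L₃ = subst (2 * g ≤_) (+-identityʳ e) (local-inequality 7 7≤m
    ((1 ∷ 4 ∷ 6 ∷ []) ∷ [])
    ((1 ∷ 2 ∷ 4 ∷ 5 ∷ []) ∷ (1 ∷ 2 ∷ 5 ∷ 6 ∷ []) ∷ [])
    ((1 ∷ 2 ∷ 5 ∷ []) ∷ []))

  L₄ : d + 2 * e ≤ c + (g + 2 * f)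
  L₄ = local-inequality 7 7≤m
    ((0 ∷ 2 ∷ 4 ∷ []) ∷ [])
    ((1 ∷ 2 ∷ 3 ∷ []) ∷ (0 ∷ 1 ∷ 3 ∷ []) ∷ (1 ∷ 3 ∷ 4 ∷ []) ∷ [])
    ((1 ∷ 3 ∷ []) ∷ (0 ∷ 1 ∷ 3 ∷ 4 ∷ []) ∷ (0 ∷ 1 ∷ 2 ∷ 3 ∷ []) ∷ (1 ∷ 2 ∷ 3 ∷ 4 ∷ []) ∷ [])

  L₅ : 2 * d ≤ b + f
  L₅ = subst (2 * d ≤_) (cong (b +_) (+-identityʳ f)) (local-inequality 7 7≤m
    []
    ((0 ∷ 1 ∷ 2 ∷ []) ∷ (1 ∷ 2 ∷ 3 ∷ []) ∷ [])
    ((1 ∷ 2 ∷ []) ∷ (0 ∷ 1 ∷ 2 ∷ 3 ∷ []) ∷ []))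

  constraints : Arithmetic.Constraints k ((2 + k) C 2) refl n a b c d e f g
  constraints = record
    { total = subst₂ (λ x y → n + ((4 + k) * b + x * c) + ((2 + k) * f + ((2 + k) C 2) * g)
                              ≡ (5 + k) * a + ((3 + k) * d + y * (e + e)))
                     (trans (suc-C2 (3 + k)) (cong (3 + k +_) (suc-C2 (2 + k)))) (suc-C2 (2 + k)) total
    ; S₀ = S₀ ; S₁ = S₁ ; B₀ = B₀ ; L₁ = L₁ ; L₂ = L₂ ; L₃ = L₃ ; L₄ = L₄ ; L₅ = L₅ }

lemma4p26 : (n m : ℕ) (A : SetSystem n m) →
    Complete A → Harmonic A → n < m * (m ∸ 2) → 51 ≤ m →
    ((I : Subset m) → Nonconsecutive I → ∣ I ∣ ≡ 3 → H A I ≡ ⊥) →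
    NonnegComb m n
lemma4p26 n m A complete harm n< 51≤m spread-empty with m≤n⇒∃[o]m+o≡n (≤-trans (≤-by-computation {5}) 51≤m)
... | k , refl = nonnegComb (combination n< (Bounds.constraints k 2≤k complete harm spread-empty))
  where
  open Arithmetic k ((2 + k) C 2) refl
  -- only m ≥ 7 is used
  2≤k : 2 ≤ k
  2≤k = +-cancelˡ-≤ 5 2 k (≤-trans (≤-by-computation {7}) 51≤m)
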